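{- Let $k$ be a positive integer. Let $T$ be a tournament of order $m\ge 4k$ and let $(v_1,\dots,v_m)$ be a local median order of $T$. Then there are at least $k$ internally disjoint directed $2$-out-paths with origin $v_1$ and terminus in $\{v_{m-4k+2},\dots,v_m\}$.
   Context: A tournament is an orientation of a complete graph; $u$ dominates $v$ if $uv$ is an arc. A local median order of $T$ is an ordering $(v_1,\dots,v_m)$ of its vertices such that for all $1\le i<j\le m$, $v_i$ dominates at least half of $v_{i+1},\dots,v_j$ and $v_j$ is dominated by at least half of $v_i,\dots,v_{j-1}$. A directed $2$-out-path with origin $x$ and terminus $z$ is a path $(x,y,z)$ with arcs $xy$ and $yz$; paths are internally disjoint if their internal vertices are pairwise distinct and not on the other paths. -}

module Defs where

open import Data.Nat using (ℕ; _<_; _+_; _*_; _∸_; _≤_; _<ᵇ_; _≤ᵇ_)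
open import Data.Bool using (Bool; true; false; not; _∧_; if_then_else_)
open import Data.Fin using (Fin; toℕ)
open import Data.List using (map; allFin)
open import Data.Nat.ListAction using (sum)
open import Data.Product using (_×_; Σ)
open import Data.Fin.Permutation using (Permutation′; _⟨$⟩ʳ_)
open import Relation.Binary.PropositionalEquality using (_≡_; _≢_)

-- A tournament on the vertex set Fin m: arc u v ≡ true means u dominates v.
-- No loops, and for distinct u v exactly one of the arcs uv, vu is present.
record Tournament (m : ℕ) : Set where
  field
    arc        : Fin m → Fin m → Bool
    irrefl     : ∀ u → arc u u ≡ false
    tournament : ∀ u v → u ≢ v → arc u v ≡ not (arc v u)
open Tournament public

count : {m : ℕ} → (Fin m → Bool) → ℕ
count {m} P = sum (map (λ l → if P l then 1 else 0) (allFin m))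

-- An ordering (v_1,…,v_m) of the vertices: position p (0-based) ↦ vertex σ p.
Ordering : ℕ → Set
Ordering m = Permutation′ m

-- Local median order: for all positions i < j,
--  v_i dominates at least half of v_{i+1},…,v_j, and
--  v_j is dominated by at least half of v_i,…,v_{j-1}.
-- (Both sets have j - i elements; "at least half" is  2·count ≥ j - i.)
IsLocalMedianOrder : {m : ℕ} → Tournament m → Ordering m → Set
IsLocalMedianOrder {m} T σ =
  ∀ (i j : Fin m) → toℕ i < toℕ j →
    ((toℕ j ∸ toℕ i) ≤ 2 * count (λ l → (toℕ i <ᵇ toℕ l) ∧ (toℕ l ≤ᵇ toℕ j)
                                          ∧ arc T (σ ⟨$⟩ʳ i) (σ ⟨$⟩ʳ l)))
    ×
    ((toℕ j ∸ toℕ i) ≤ 2 * count (λ l → (toℕ i ≤ᵇ toℕ l) ∧ (toℕ l <ᵇ toℕ j)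
                                          ∧ arc T (σ ⟨$⟩ʳ l) (σ ⟨$⟩ʳ j)))

Is2OutPath : {m : ℕ} → Tournament m → Fin m → Fin m → Fin m → Set
Is2OutPath T x y z = (arc T x y ≡ true) × (arc T y z ≡ true)

-- k directed 2-out-paths (x, mid t, end t), t : Fin k, that are internally
-- disjoint: the internal vertices are pairwise distinct and no internal
-- vertex lies on another path (the common origin x is never internal since
-- x → mid t is an arc; y ≠ own terminus likewise).
InternallyDisjoint2OutPaths : {m : ℕ} → Tournament m → (k : ℕ) →
  Fin m → (Fin k → Fin m) → (Fin k → Fin m) → Set
InternallyDisjoint2OutPaths T k x mid end =
  (∀ t → Is2OutPath T x (mid t) (end t)) ×
  (∀ s t → s ≢ t → mid s ≢ mid t) ×
  (∀ s t → s ≢ t → mid s ≢ end t)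

-- In a local median order v₀ v₁ … consecutive vertices are joined by arcs vᵢ → vᵢ₊₁ (the median
-- condition on the pair i, i+1). Call the last 4k − 1 positions the tail. If v₀ dominates at least 2k
-- tail vertices, one parity class of them, the last vertex excepted, has k members vᵢ, and the paths
-- v₀ vᵢ vᵢ₊₁ are internally disjoint. Otherwise the tail has at least 2k vertices not dominated by v₀;
-- let vₚ be the first. The median condition on (v₀, vₚ) makes vₚ dominated by at least half of
-- v₀ … vₚ₋₁, and on (v₀, vₘ₋₁) makes v₀ dominate at least half of the rest; counting, the
-- out-neighbours vᵢ of v₀ with i < p and vᵢ → vₚ, together with one parity class of out-neighbours
-- after p, number at least k. They give the paths v₀ vᵢ vₚ and v₀ vᵢ vᵢ₊₁.
module Submission where

open import Defs
open import Data.Nat using (ℕ; _+_; _*_; _≤_; _∸_)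
open import Data.Fin using (Fin; toℕ)
open import Data.Fin.Permutation using (_⟨$⟩ʳ_)
open import Data.Product using (Σ; _×_)
open import Relation.Binary.PropositionalEquality using (_≡_)
open import Data.Bool using (Bool; true; false; not; _∧_; if_then_else_; T)
open import Data.Bool.Properties using (T-∧; T-≡)
open import Data.Empty using (⊥-elim)
open import Data.Fin using (fromℕ<) renaming (zero to fzero; suc to fsuc)
open import Data.Fin.Properties using (toℕ-fromℕ<; toℕ-injective; toℕ<n)
open import Data.Fin.Permutation using (_⟨$⟩ˡ_; inverseˡ)
open import Data.List using (tabulate; map; _∷_; [])
open import Data.List.Properties using (map-tabulate)
open import Data.Nat hiding (Ordering)
open import Data.Nat.ListAction using (sum)
open import Data.Nat.Properties
open import Data.Nat.Tactic.RingSolver using (solve; solve-∀)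
open import Data.Product using (∃₂; _,_; proj₁; proj₂)
open import Data.Sum using (_⊎_; inj₁; inj₂)
open import Data.Unit using (tt)
open import Function using (_∘_; _⇔_; mk⇔)
open import Function.Bundles using (Equivalence)
open import Function.Definitions using (Injective)
open import Relation.Binary.PropositionalEquality
open import Relation.Nullary using (¬_; yes; no)

indicator : Bool → ℕ
indicator b = if b then 1 else 0

countFrom : ℕ → ℕ → (ℕ → Bool) → ℕ
countFrom lo zero    P = 0
countFrom lo (suc d) P = indicator (P lo) + countFrom (suc lo) d P

InWindow : ℕ → ℕ → ℕ → Set
InWindow lo d n = lo ≤ n × n < lo + d

private
  shrink : ∀ {lo d n} → InWindow (suc lo) d n → InWindow lo (suc d) n
  shrink {lo} {d} {n} (lo<n , n<) = <⇒≤ lo<n , subst (n <_) (sym (+-suc lo d)) n<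

countFrom-++ : ∀ lo d e P → countFrom lo (d + e) P ≡ countFrom lo d P + countFrom (lo + d) e P
countFrom-++ lo zero    e P rewrite +-identityʳ lo = refl
countFrom-++ lo (suc d) e P rewrite countFrom-++ (suc lo) d e P | +-suc lo d =
  sym (+-assoc (indicator (P lo)) _ _)

countFrom-mono : ∀ lo d (P Q : ℕ → Bool) →
  (∀ n → InWindow lo d n → T (P n) → T (Q n)) → countFrom lo d P ≤ countFrom lo d Q
countFrom-mono lo zero    P Q P⇒Q = z≤n
countFrom-mono lo (suc d) P Q P⇒Q =
  +-mono-≤ (head (P lo) (Q lo) (P⇒Q lo (≤-refl , m<m+n lo z<s)))
           (countFrom-mono (suc lo) d P Q (λ n w → P⇒Q n (shrink w)))
  where
  head : ∀ p q → (T p → T q) → indicator p ≤ indicator q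
  head false q     _   = z≤n
  head true  true  _   = ≤-refl
  head true  false p⇒q = ⊥-elim (p⇒q tt)

countFrom-cong : ∀ lo d (P Q : ℕ → Bool) →
  (∀ n → InWindow lo d n → P n ≡ Q n) → countFrom lo d P ≡ countFrom lo d Q
countFrom-cong lo d P Q P≡Q = ≤-antisym
  (countFrom-mono lo d P Q (λ n w → subst T (P≡Q n w)))
  (countFrom-mono lo d Q P (λ n w → subst T (sym (P≡Q n w))))

countFrom-const : ∀ lo d b → countFrom lo d (λ _ → b) ≡ indicator b * d
countFrom-const lo zero    b = sym (*-zeroʳ (indicator b))
countFrom-const lo (suc d) b rewrite countFrom-const (suc lo) d b | *-suc (indicator b) d = refl

countFrom-split : ∀ lo d (P Q : ℕ → Bool) →
  countFrom lo d P ≡ countFrom lo d (λ n → P n ∧ Q n) + countFrom lo d (λ n → P n ∧ not (Q n))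
countFrom-split lo zero    P Q = refl
countFrom-split lo (suc d) P Q
  rewrite countFrom-split (suc lo) d P Q = head (P lo) (Q lo)
  where
  head : ∀ p q {x y} → indicator p + (x + y) ≡ (indicator (p ∧ q) + x) + (indicator (p ∧ not q) + y)
  head false q           = refl
  head true  true        = refl
  head true  false {x} {y} = sym (+-suc x y)

countFrom-≤ : ∀ lo d P → countFrom lo d P ≤ d
countFrom-≤ lo d P = begin
  countFrom lo d P            ≤⟨ countFrom-mono lo d P (λ _ → true) (λ _ _ _ → tt) ⟩
  countFrom lo d (λ _ → true) ≡⟨ trans (countFrom-const lo d true) (*-identityˡ d) ⟩
  d                           ∎
  where
  open ≤-Reasoning

countFrom-vanishes : ∀ lo d P → (∀ n → InWindow lo d n → P n ≡ false) → countFrom lo d P ≡ 0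
countFrom-vanishes lo d P P≡false =
  trans (countFrom-cong lo d P (λ _ → false) P≡false) (countFrom-const lo d false)

countFrom-suc-≤ : ∀ lo d P → countFrom lo (suc d) P ≤ countFrom lo d P + 1
countFrom-suc-≤ lo d P = begin
  countFrom lo (suc d) P                         ≡⟨ cong (λ e → countFrom lo e P) (+-comm 1 d) ⟩
  countFrom lo (d + 1) P                         ≡⟨ countFrom-++ lo d 1 P ⟩
  countFrom lo d P + countFrom (lo + d) 1 P      ≤⟨ +-monoʳ-≤ (countFrom lo d P) (countFrom-≤ (lo + d) 1 P) ⟩
  countFrom lo d P + 1                           ∎
  where
  open ≤-Reasoning

NoTwoConsecutive : (ℕ → Bool) → Set
NoTwoConsecutive Q = ∀ n → T (Q n) → ¬ T (Q (suc n))

isOdd : ℕ → Bool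
isOdd zero    = false
isOdd (suc n) = not (isOdd n)

private
  T-not-both : ∀ b → T b → ¬ T (not b)
  T-not-both true _ ()

  +≤2* : ∀ {x y z} → x ≤ z → y ≤ z → x + y ≤ 2 * z
  +≤2* {z = z} x≤z y≤z = ≤-trans (+-mono-≤ x≤z y≤z) (≤-reflexive (cong (z +_) (sym (+-identityʳ z))))

  halfOfWindow : ∀ lo d P Q c →
    countFrom lo d (λ n → P n ∧ Q n) + countFrom lo d (λ n → P n ∧ not (Q n)) ≤ 2 * c →
    countFrom lo (suc d) P ≤ 2 * c + 1
  halfOfWindow lo d P Q c ≤2c = ≤-trans (countFrom-suc-≤ lo d P)
    (+-monoˡ-≤ 1 (≤-trans (≤-reflexive (countFrom-split lo d P Q)) ≤2c))

-- The last point of the window is left out, so that every n counted on the right has n + 1 in the window.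
sparseClassHalf : ∀ lo d P → Σ (ℕ → Bool) λ Q → NoTwoConsecutive Q ×
  countFrom lo (suc d) P ≤ 2 * countFrom lo d (λ n → P n ∧ Q n) + 1
sparseClassHalf lo d P = larger (≤-total evens odds)
  where
  evens odds : ℕ
  evens = countFrom lo d (λ n → P n ∧ not (isOdd n))
  odds  = countFrom lo d (λ n → P n ∧ isOdd n)
  larger : evens ≤ odds ⊎ odds ≤ evens → Σ (ℕ → Bool) λ Q → NoTwoConsecutive Q ×
    countFrom lo (suc d) P ≤ 2 * countFrom lo d (λ n → P n ∧ Q n) + 1
  larger (inj₁ evens≤odds) =
    isOdd , (λ n → T-not-both (isOdd n)) , halfOfWindow lo d P isOdd odds (+≤2* ≤-refl evens≤odds)
  larger (inj₂ odds≤evens) =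
    (not ∘ isOdd) , (λ n → T-not-both (not (isOdd n))) , halfOfWindow lo d P isOdd evens (+≤2* odds≤evens ≤-refl)

firstFalse : ∀ lo d (P : ℕ → Bool) → 0 < countFrom lo d (λ n → not (P n)) →
  ∃₂ λ j e → d ≡ j + suc e × P (lo + j) ≡ false × countFrom lo j (λ n → not (P n)) ≡ 0
firstFalse lo (suc d) P 0<count with P lo in P-lo
... | false = 0 , d , refl , trans (cong P (+-identityʳ lo)) P-lo , refl
... | true with firstFalse (suc lo) d P 0<count
...   | j , e , d≡ , P-false , before =
  suc j , e , cong suc d≡ , trans (cong P (+-suc lo j)) P-false ,
  trans (cong (λ b → indicator (not b) + countFrom (suc lo) j (λ n → not (P n))) P-lo) before

select : ∀ k lo d (P : ℕ → Bool) → k ≤ countFrom lo d P →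
  Σ (Fin k → ℕ) λ f → Injective _≡_ _≡_ f × (∀ t → InWindow lo d (f t) × T (P (f t)))
select zero    lo d       P _ = (λ ()) , (λ {}) , (λ ())
select (suc k) lo (suc d) P k<count with P lo in P-lo
... | false with select (suc k) (suc lo) d P k<count
...   | f , f-inj , f-ok = f , f-inj , λ t → shrink (proj₁ (f-ok t)) , proj₂ (f-ok t)
select (suc k) lo (suc d) P (s≤s k≤count) | true with select k (suc lo) d P k≤count
...   | f , f-inj , f-ok = g , g-inj , g-ok
  where
  g : Fin (suc k) → ℕ
  g fzero    = lo
  g (fsuc t) = f t
  g-inj : Injective _≡_ _≡_ g
  g-inj {fzero}  {fzero}  _   = refl
  g-inj {fzero}  {fsuc t} eq  = ⊥-elim (<-irrefl eq (proj₁ (proj₁ (f-ok t))))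
  g-inj {fsuc s} {fzero}  eq  = ⊥-elim (<-irrefl (sym eq) (proj₁ (proj₁ (f-ok s))))
  g-inj {fsuc s} {fsuc t} eq  = cong fsuc (f-inj eq)
  g-ok : ∀ t → InWindow lo (suc d) (g t) × T (P (g t))
  g-ok fzero    = (≤-refl , m<m+n lo z<s) , subst T (sym P-lo) tt
  g-ok (fsuc t) = shrink (proj₁ (f-ok t)) , proj₂ (f-ok t)

sum-tabulate-indicator : ∀ lo m (g : Fin m → Bool) (h : ℕ → Bool) → (∀ i → g i ≡ h (lo + toℕ i)) →
  sum (tabulate (λ i → indicator (g i))) ≡ countFrom lo m h
sum-tabulate-indicator lo zero    g h g≡h = refl
sum-tabulate-indicator lo (suc m) g h g≡h =
  cong₂ _+_ (cong indicator (trans (g≡h fzero) (cong h (+-identityʳ lo))))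
            (sum-tabulate-indicator (suc lo) m (g ∘ fsuc) h (λ i → trans (g≡h (fsuc i)) (cong h (+-suc lo (toℕ i)))))

count≡countFrom : ∀ {m} (g : Fin m → Bool) (h : ℕ → Bool) → (∀ i → g i ≡ h (toℕ i)) →
  count g ≡ countFrom 0 m h
count≡countFrom {m} g h g≡h =
  trans (cong sum (map-tabulate (λ i → i) (λ l → indicator (g l))))
        (sum-tabulate-indicator 0 m g h g≡h)

countFrom-window : ∀ lo d m (above below P : ℕ → Bool) → lo + d ≤ m →
  (∀ n → T (above n) ⇔ lo ≤ n) → (∀ n → T (below n) ⇔ n < lo + d) →
  countFrom 0 m (λ n → above n ∧ below n ∧ P n) ≡ countFrom lo d P
countFrom-window lo d m above below P lo+d≤m above⇔ below⇔ = begin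
  countFrom 0 m wP
    ≡⟨ cong (λ e → countFrom 0 e wP) (sym (m+[n∸m]≡n lo+d≤m)) ⟩
  countFrom 0 ((lo + d) + (m ∸ (lo + d))) wP
    ≡⟨ countFrom-++ 0 (lo + d) (m ∸ (lo + d)) wP ⟩
  countFrom 0 (lo + d) wP + countFrom (lo + d) (m ∸ (lo + d)) wP
    ≡⟨ cong₂ _+_ (countFrom-++ 0 lo d wP)
                 (countFrom-vanishes (lo + d) (m ∸ (lo + d)) wP (λ n n∈ → beyond n (≤⇒≯ (proj₁ n∈)))) ⟩
  (countFrom 0 lo wP + countFrom lo d wP) + 0
    ≡⟨ cong₂ (λ x y → (x + y) + 0)
             (countFrom-vanishes 0 lo wP (λ n n∈ → before n (<⇒≱ (proj₂ n∈))))
             (countFrom-cong lo d wP P inside) ⟩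
  countFrom lo d P + 0
    ≡⟨ +-identityʳ _ ⟩
  countFrom lo d P ∎
  where
  open ≡-Reasoning
  wP : ℕ → Bool
  wP n = above n ∧ below n ∧ P n
  before : ∀ n → ¬ lo ≤ n → wP n ≡ false
  before n lo≰n with above n in above-n
  ... | false = refl
  ... | true  = ⊥-elim (lo≰n (Equivalence.to (above⇔ n) (subst T (sym above-n) tt)))
  beyond : ∀ n → ¬ n < lo + d → wP n ≡ false
  beyond n n≮ with above n | below n in below-n
  ... | false | _     = refl
  ... | true  | false = refl
  ... | true  | true  = ⊥-elim (n≮ (Equivalence.to (below⇔ n) (subst T (sym below-n) tt)))
  inside : ∀ n → InWindow lo d n → wP n ≡ P n
  inside n (lo≤n , n<) with above n | Equivalence.from (above⇔ n) lo≤n | below n | Equivalence.from (below⇔ n) n<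
  ... | true | _ | true | _ = refl

<ᵇ≡true : ∀ {n p} → n < p → (n <ᵇ p) ≡ true
<ᵇ≡true n<p = Equivalence.to T-≡ (<⇒<ᵇ n<p)

≥⇒<ᵇ≡false : ∀ {n p} → p ≤ n → (n <ᵇ p) ≡ false
≥⇒<ᵇ≡false {n} {p} p≤n with n <ᵇ p in n<ᵇp
... | false = refl
... | true  = ⊥-elim (<⇒≱ (<ᵇ⇒< n p (subst T (sym n<ᵇp) tt)) p≤n)

countFrom-complement : ∀ lo d P → countFrom lo d P + countFrom lo d (λ n → not (P n)) ≡ d
countFrom-complement lo d P =
  trans (sym (countFrom-split lo d (λ _ → true) P)) (trans (countFrom-const lo d true) (*-identityˡ d))

countFrom-cover : ∀ lo d (P Q R : ℕ → Bool) → (∀ n → InWindow lo d n → T (P n) → T (Q n) ⊎ T (R n)) →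
  countFrom lo d P ≤ countFrom lo d Q + countFrom lo d R
countFrom-cover lo d P Q R P⇒Q⊎R = begin
  countFrom lo d P
    ≡⟨ countFrom-split lo d P Q ⟩
  countFrom lo d (λ n → P n ∧ Q n) + countFrom lo d (λ n → P n ∧ not (Q n))
    ≤⟨ +-mono-≤ (countFrom-mono lo d _ Q (λ n _ → proj₂ ∘ Equivalence.to T-∧))
                (countFrom-mono lo d _ R (λ n n∈ → notQ⇒R n n∈ ∘ Equivalence.to T-∧)) ⟩
  countFrom lo d Q + countFrom lo d R ∎
  where
  open ≤-Reasoning
  notQ⇒R : ∀ n → InWindow lo d n → T (P n) × T (not (Q n)) → T (R n)
  notQ⇒R n n∈ (P-n , ¬Q-n) with P⇒Q⊎R n n∈ P-n
  ... | inj₁ Q-n = ⊥-elim (T-not-both (Q n) Q-n ¬Q-n)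
  ... | inj₂ R-n = R-n

half-≤ : ∀ {k n} → 2 * k ≤ 2 * n + 1 → k ≤ n
half-≤ {k} {n} 2k≤2n+1 = ≤-pred (*-cancelˡ-< 2 k (suc n) (begin-strict
  2 * k        ≤⟨ 2k≤2n+1 ⟩
  2 * n + 1    <⟨ n<1+n (2 * n + 1) ⟩
  suc (2 * n + 1) ≡⟨ solve (n ∷ []) ⟩
  2 * suc n    ∎))
  where
  open ≤-Reasoning

pivotArithmetic : ∀ {k p′ e X U V q W E} →
  suc p′ ≤ 2 * (X + U) → V + U ≡ p′ → p′ + suc e ≤ 2 * (V + q) → q + W ≡ e → 2 * k ≤ suc W →
  q ≤ 2 * E + 1 → k ≤ X + E
pivotArithmetic {k} {p′} {e} {X} {U} {V} {q} {W} {E} in-degree before out-degree after many sparse =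
  half-≤ (begin
    2 * k                   ≤⟨ m≤m+n (2 * k) 1 ⟩
    2 * k + 1               ≤⟨ +-cancelʳ-≤ (p′ + 1) _ _ combined ⟩
    2 * X + (2 * E + 1)     ≡⟨ solve (X ∷ E ∷ []) ⟩
    2 * (X + E) + 1         ∎)
  where
  open ≤-Reasoning
  beforeBound : 2 * V + 1 ≤ 2 * X + p′
  beforeBound = +-cancelʳ-≤ p′ _ _ (begin
    2 * V + 1 + p′        ≡⟨ solve (V ∷ p′ ∷ []) ⟩
    2 * V + suc p′        ≤⟨ +-monoʳ-≤ (2 * V) in-degree ⟩
    2 * V + 2 * (X + U)   ≡⟨ solve (V ∷ X ∷ U ∷ []) ⟩
    2 * X + 2 * (V + U)   ≡⟨ cong (λ z → 2 * X + 2 * z) before ⟩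
    2 * X + 2 * p′        ≡⟨ solve (X ∷ p′ ∷ []) ⟩
    2 * X + p′ + p′       ∎)
  afterBound : p′ + 1 + W ≤ 2 * V + q
  afterBound = +-cancelʳ-≤ q _ _ (begin
    p′ + 1 + W + q        ≡⟨ solve (p′ ∷ W ∷ q ∷ []) ⟩
    p′ + suc (q + W)      ≡⟨ cong (λ z → p′ + suc z) after ⟩
    p′ + suc e            ≤⟨ out-degree ⟩
    2 * (V + q)           ≡⟨ solve (V ∷ q ∷ []) ⟩
    2 * V + q + q         ∎)
  combined : 2 * k + 1 + (p′ + 1) ≤ 2 * X + (2 * E + 1) + (p′ + 1)
  combined = begin
    2 * k + 1 + (p′ + 1)              ≡⟨ solve (k ∷ p′ ∷ []) ⟩
    2 * k + (p′ + 2)                  ≤⟨ +-monoˡ-≤ (p′ + 2) many ⟩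
    suc W + (p′ + 2)                  ≡⟨ solve (W ∷ p′ ∷ []) ⟩
    p′ + 1 + W + 2                    ≤⟨ +-monoˡ-≤ 2 afterBound ⟩
    2 * V + q + 2                     ≡⟨ solve (V ∷ q ∷ []) ⟩
    2 * V + 1 + (q + 1)               ≤⟨ +-monoˡ-≤ (q + 1) beforeBound ⟩
    2 * X + p′ + (q + 1)              ≡⟨ solve (X ∷ p′ ∷ q ∷ []) ⟩
    2 * X + q + (p′ + 1)              ≤⟨ +-monoˡ-≤ (p′ + 1) (+-monoʳ-≤ (2 * X) sparse) ⟩
    2 * X + (2 * E + 1) + (p′ + 1)    ∎

complement-≥ : ∀ {k′ x y} → x + y ≡ 3 + 4 * k′ → x < 2 * suc k′ → 2 * suc k′ ≤ y
complement-≥ {k′} {x} {y} x+y≡ x< = +-cancelˡ-≤ (2 * suc k′) _ _ (begin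
  2 * suc k′ + 2 * suc k′   ≡⟨ solve (k′ ∷ []) ⟩
  suc (3 + 4 * k′)          ≡⟨ cong suc (sym x+y≡) ⟩
  suc x + y                 ≤⟨ +-monoˡ-≤ y x< ⟩
  2 * suc k′ + y            ∎)
  where
  open ≤-Reasoning

module MedianOrder {m′ : ℕ} (G : Tournament (suc m′)) (σ : Ordering (suc m′)) (median : IsLocalMedianOrder G σ) where

  m : ℕ
  m = suc m′

  -- positions beyond the last one are clamped to it
  position : ℕ → Fin m
  position n = fromℕ< (s≤s (m⊓n≤n n m′))

  toℕ-position : ∀ {n} → n < m → toℕ (position n) ≡ n
  toℕ-position {n} (s≤s n≤m′) = trans (toℕ-fromℕ< _) (m≤n⇒m⊓n≡m n≤m′)

  position-toℕ : ∀ (l : Fin m) → position (toℕ l) ≡ l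
  position-toℕ l = toℕ-injective (toℕ-position (toℕ<n l))

  vertex : ℕ → Fin m
  vertex n = σ ⟨$⟩ʳ position n

  vertex-injective : ∀ {n n′} → n < m → n′ < m → vertex n ≡ vertex n′ → n ≡ n′
  vertex-injective {n} {n′} n<m n′<m eq = begin
    n                                     ≡⟨ sym (toℕ-position n<m) ⟩
    toℕ (position n)                      ≡⟨ cong toℕ (sym (inverseˡ σ)) ⟩
    toℕ (σ ⟨$⟩ˡ vertex n)                 ≡⟨ cong (toℕ ∘ (σ ⟨$⟩ˡ_)) eq ⟩
    toℕ (σ ⟨$⟩ˡ vertex n′)                ≡⟨ cong toℕ (inverseˡ σ) ⟩
    toℕ (position n′)                     ≡⟨ toℕ-position n′<m ⟩
    n′                                    ∎
    where
    open ≡-Reasoning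

  infix 5 _⟶_
  _⟶_ : ℕ → ℕ → Bool
  i ⟶ j = arc G (vertex i) (vertex j)

  private
    <ᵇ⇔< : ∀ i n → T (i <ᵇ n) ⇔ i < n
    <ᵇ⇔< i n = mk⇔ (<ᵇ⇒< i n) <⇒<ᵇ

    ≤ᵇ⇔≤ : ∀ i n → T (i ≤ᵇ n) ⇔ i ≤ n
    ≤ᵇ⇔≤ i n = mk⇔ (≤ᵇ⇒≤ i n) ≤⇒≤ᵇ

    ≤ᵇ⇔<suc : ∀ n j → T (n ≤ᵇ j) ⇔ n < suc j
    ≤ᵇ⇔<suc n j = mk⇔ (s≤s ∘ ≤ᵇ⇒≤ n j) (≤⇒≤ᵇ ∘ ≤-pred)

  private
    toℕ-position-< : ∀ {i d} → 0 < d → i + d < m → toℕ (position i) < toℕ (position (i + d))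
    toℕ-position-< {i} {d} 0<d i+d<m =
      subst₂ _<_ (sym (toℕ-position (≤-<-trans (m≤m+n i d) i+d<m))) (sym (toℕ-position i+d<m)) (m<m+n i 0<d)

    toℕ-position-∸ : ∀ {i d} → i + d < m → toℕ (position (i + d)) ∸ toℕ (position i) ≡ d
    toℕ-position-∸ {i} {d} i+d<m =
      trans (cong₂ _∸_ (toℕ-position i+d<m) (toℕ-position (≤-<-trans (m≤m+n i d) i+d<m))) (m+n∸m≡n i d)

  medianOut : ∀ i d → 0 < d → i + d < m → d ≤ 2 * countFrom (suc i) d (i ⟶_)
  medianOut i d 0<d i+d<m = begin
    d                                                          ≡⟨ sym (toℕ-position-∸ i+d<m) ⟩
    toℕ (position (i + d)) ∸ toℕ (position i)                  ≤⟨ proj₁ (median _ _ (toℕ-position-< 0<d i+d<m)) ⟩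
    2 * count aheadᶠ                                           ≡⟨ cong (2 *_) (count≡countFrom aheadᶠ ahead pointwise) ⟩
    2 * countFrom 0 m ahead
      ≡⟨ cong (2 *_) (countFrom-window (suc i) d m _ _ (i ⟶_) i+d<m (<ᵇ⇔< i) (λ n → ≤ᵇ⇔<suc n (i + d))) ⟩
    2 * countFrom (suc i) d (i ⟶_)                             ∎
    where
    open ≤-Reasoning
    ahead : ℕ → Bool
    ahead n = (i <ᵇ n) ∧ (n ≤ᵇ i + d) ∧ (i ⟶ n)
    aheadᶠ : Fin m → Bool
    aheadᶠ l = (toℕ (position i) <ᵇ toℕ l) ∧ (toℕ l ≤ᵇ toℕ (position (i + d))) ∧ arc G (vertex i) (σ ⟨$⟩ʳ l)
    pointwise : ∀ l → aheadᶠ l ≡ ahead (toℕ l)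
    pointwise l rewrite toℕ-position (≤-<-trans (m≤m+n i d) i+d<m) | toℕ-position i+d<m | position-toℕ l = refl

  medianIn : ∀ i d → 0 < d → i + d < m → d ≤ 2 * countFrom i d (_⟶ (i + d))
  medianIn i d 0<d i+d<m = begin
    d                                                          ≡⟨ sym (toℕ-position-∸ i+d<m) ⟩
    toℕ (position (i + d)) ∸ toℕ (position i)                  ≤⟨ proj₂ (median _ _ (toℕ-position-< 0<d i+d<m)) ⟩
    2 * count behindᶠ                                          ≡⟨ cong (2 *_) (count≡countFrom behindᶠ behind pointwise) ⟩
    2 * countFrom 0 m behind
      ≡⟨ cong (2 *_) (countFrom-window i d m _ _ (_⟶ i + d) (<⇒≤ i+d<m) (≤ᵇ⇔≤ i) (λ n → <ᵇ⇔< n (i + d))) ⟩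
    2 * countFrom i d (_⟶ (i + d))                             ∎
    where
    open ≤-Reasoning
    behind : ℕ → Bool
    behind n = (i ≤ᵇ n) ∧ (n <ᵇ i + d) ∧ (n ⟶ i + d)
    behindᶠ : Fin m → Bool
    behindᶠ l = (toℕ (position i) ≤ᵇ toℕ l) ∧ (toℕ l <ᵇ toℕ (position (i + d))) ∧ arc G (σ ⟨$⟩ʳ l) (vertex (i + d))
    pointwise : ∀ l → behindᶠ l ≡ behind (toℕ l)
    pointwise l rewrite toℕ-position (≤-<-trans (m≤m+n i d) i+d<m) | toℕ-position i+d<m | position-toℕ l = refl

  successor-arc : ∀ i → suc i < m → T (i ⟶ suc i)
  successor-arc i i+1<m with i ⟶ suc i | medianOut i 1 z<s (subst (_< m) (+-comm 1 i) i+1<m)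
  ... | true  | _ = tt
  ... | false | ()

  record TailPath (a n e : ℕ) : Set where
    constructor tailPath
    field
      mid<m  : n < m
      end<m  : e < m
      first  : T (0 ⟶ n)
      second : T (n ⟶ e)
      inTail : a ≤ e
  open TailPath

  PathsIntoTail : ℕ → ℕ → Set
  PathsIntoTail k a = Σ (Fin k → Fin m) λ mid → Σ (Fin k → Fin m) λ end →
    InternallyDisjoint2OutPaths G k (vertex 0) mid end ×
    (∀ t → Σ (Fin m) λ p → (end t ≡ σ ⟨$⟩ʳ p) × (a ≤ toℕ p))

  fanPaths : ∀ {k a} lo d (M : ℕ → Bool) (e : ℕ → ℕ) → k ≤ countFrom lo d M →
    (∀ n → InWindow lo d n → T (M n) → TailPath a n (e n)) →
    (∀ n n′ → T (M n) → T (M n′) → n′ ≢ e n) → PathsIntoTail k a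
  fanPaths {k} {a} lo d M e k≤count path separated with select k lo d M k≤count
  ... | f , f-injective , f-ok = vertex ∘ f , vertex ∘ e ∘ f , (arcs , mids-distinct , mid≢end) , terminus
    where
    path-at : ∀ t → TailPath a (f t) (e (f t))
    path-at t = path (f t) (proj₁ (f-ok t)) (proj₂ (f-ok t))
    arcs : ∀ t → Is2OutPath G (vertex 0) (vertex (f t)) (vertex (e (f t)))
    arcs t = Equivalence.to T-≡ (first (path-at t)) , Equivalence.to T-≡ (second (path-at t))
    mids-distinct : ∀ s t → s ≢ t → vertex (f s) ≢ vertex (f t)
    mids-distinct s t s≢t eq = s≢t (f-injective (vertex-injective (mid<m (path-at s)) (mid<m (path-at t)) eq))
    mid≢end : ∀ s t → s ≢ t → vertex (f s) ≢ vertex (e (f t))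
    mid≢end s t _ eq = separated (f t) (f s) (proj₂ (f-ok t)) (proj₂ (f-ok s))
                         (vertex-injective (mid<m (path-at s)) (end<m (path-at t)) eq)
    terminus : ∀ t → Σ (Fin m) λ p → (vertex (e (f t)) ≡ σ ⟨$⟩ʳ p) × (a ≤ toℕ p)
    terminus t = position (e (f t)) , refl ,
                 subst (a ≤_) (sym (toℕ-position (end<m (path-at t)))) (inTail (path-at t))

  successorFan : ∀ {k} a lo d (Q : ℕ → Bool) → NoTwoConsecutive Q → a ≤ lo → lo + suc d ≤ m →
    k ≤ countFrom lo d (λ n → (0 ⟶ n) ∧ Q n) → PathsIntoTail k a
  successorFan a lo d Q sparse a≤lo window≤m k≤count =
    fanPaths lo d (λ n → (0 ⟶ n) ∧ Q n) suc k≤count path separated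
    where
    path : ∀ n → InWindow lo d n → T ((0 ⟶ n) ∧ Q n) → TailPath a n (suc n)
    path n (lo≤n , n<) M-n = tailPath (<-trans (n<1+n n) suc-n<m) suc-n<m (proj₁ (Equivalence.to T-∧ M-n))
                                      (successor-arc n suc-n<m) (≤-trans a≤lo (m≤n⇒m≤1+n lo≤n))
      where
      suc-n<m : suc n < m
      suc-n<m = ≤-trans (subst (suc (suc n) ≤_) (sym (+-suc lo d)) (s≤s n<)) window≤m
    separated : ∀ n n′ → T ((0 ⟶ n) ∧ Q n) → T ((0 ⟶ n′) ∧ Q n′) → n′ ≢ suc n
    separated n n′ M-n M-n′ refl = sparse n (proj₂ (Equivalence.to T-∧ M-n)) (proj₂ (Equivalence.to T-∧ M-n′))

  pivotFan : ∀ {k} a p′ e′ (Q : ℕ → Bool) → NoTwoConsecutive Q → a ≤ suc p′ → suc p′ + suc e′ < m →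
    (0 ⟶ suc p′) ≡ false →
    k ≤ countFrom 1 p′ (λ n → (0 ⟶ n) ∧ (n ⟶ suc p′)) + countFrom (suc (suc p′)) e′ (λ n → (0 ⟶ n) ∧ Q n) →
    PathsIntoTail k a
  pivotFan a p′ e′ Q sparse a≤p window<m p-unreached k≤count =
    fanPaths 1 (p′ + suc e′) M e (≤-trans k≤count (≤-reflexive count-M)) path separated
    where
    p : ℕ
    p = suc p′
    M : ℕ → Bool
    M n = (0 ⟶ n) ∧ (if n <ᵇ p then n ⟶ p else Q n)
    e : ℕ → ℕ
    e n = if n <ᵇ p then p else suc n
    p<m : p < m
    p<m = ≤-<-trans (m≤m+n p (suc e′)) window<m
    count-M : countFrom 1 p′ (λ n → (0 ⟶ n) ∧ (n ⟶ p)) + countFrom (suc p) e′ (λ n → (0 ⟶ n) ∧ Q n)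
              ≡ countFrom 1 (p′ + suc e′) M
    count-M = begin
      countFrom 1 p′ (λ n → (0 ⟶ n) ∧ (n ⟶ p)) + countFrom (suc p) e′ (λ n → (0 ⟶ n) ∧ Q n)
        ≡⟨ cong₂ _+_ (countFrom-cong 1 p′ _ M (λ n (_ , n<p) → cong M-if (sym (<ᵇ≡true n<p))))
                     (countFrom-cong (suc p) e′ _ M (λ n (p<n , _) → cong M-if (sym (≥⇒<ᵇ≡false (<⇒≤ p<n))))) ⟩
      countFrom 1 p′ M + countFrom (suc p) e′ M
        ≡⟨ cong (λ b → countFrom 1 p′ M + (indicator (b ∧ (if p <ᵇ p then p ⟶ p else Q p)) + countFrom (suc p) e′ M))
                (sym p-unreached) ⟩
      countFrom 1 p′ M + countFrom p (suc e′) M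
        ≡⟨ sym (countFrom-++ 1 p′ (suc e′) M) ⟩
      countFrom 1 (p′ + suc e′) M ∎
      where
      open ≡-Reasoning
      M-if : ∀ {n} → Bool → Bool
      M-if {n} before = (0 ⟶ n) ∧ (if before then n ⟶ p else Q n)
    path : ∀ n → InWindow 1 (p′ + suc e′) n → T (M n) → TailPath a n (e n)
    path n (_ , n<) M-n with n <? p
    ... | yes n<p rewrite <ᵇ≡true n<p =
      tailPath (<-trans n<p p<m) p<m (proj₁ (Equivalence.to T-∧ M-n)) (proj₂ (Equivalence.to T-∧ M-n)) a≤p
    ... | no n≮p rewrite ≥⇒<ᵇ≡false (≮⇒≥ n≮p) =
      tailPath (<-trans (n<1+n n) suc-n<m) suc-n<m (proj₁ (Equivalence.to T-∧ M-n)) (successor-arc n suc-n<m)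
               (≤-trans a≤p (≤-trans (≮⇒≥ n≮p) (n≤1+n n)))
      where
      suc-n<m : suc n < m
      suc-n<m = ≤-trans (s≤s n<) window<m
    separated : ∀ n n′ → T (M n) → T (M n′) → n′ ≢ e n
    separated n n′ M-n M-n′ n′≡ with n <? p
    ... | yes n<p rewrite <ᵇ≡true n<p | n′≡ | p-unreached = M-n′
    ... | no n≮p rewrite ≥⇒<ᵇ≡false (≮⇒≥ n≮p) | n′≡ | ≥⇒<ᵇ≡false (m≤n⇒m≤1+n (≮⇒≥ n≮p)) =
      sparse n (proj₂ (Equivalence.to T-∧ M-n)) (proj₂ (Equivalence.to T-∧ M-n′))

  denseTail : ∀ {k} a d → a + suc d ≤ m → 2 * k ≤ countFrom a (suc d) (0 ⟶_) → PathsIntoTail k a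
  denseTail a d window≤m many with sparseClassHalf a d (0 ⟶_)
  ... | Q , sparse , classBound = successorFan a a d Q sparse ≤-refl window≤m (half-≤ (≤-trans many classBound))

  unreachedPivot : ∀ {k} a p′ e′ → a ≤ suc p′ → suc p′ + suc (suc e′) ≡ m → (0 ⟶ suc p′) ≡ false →
    2 * k ≤ suc (countFrom (suc (suc p′)) (suc e′) (λ n → not (0 ⟶ n))) → PathsIntoTail k a
  unreachedPivot a p′ e′ a≤p tail-end p-unreached many with sparseClassHalf (suc (suc p′)) e′ (0 ⟶_)
  ... | Q , sparse , classBound =
    pivotFan a p′ e′ Q sparse a≤p window<m p-unreached
      (pivotArithmetic {X = reachedBefore} {U = unreachedBefore} {E = countFrom (suc p) e′ (λ n → (0 ⟶ n) ∧ Q n)}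
                       in-degree (countFrom-complement 1 p′ (0 ⟶_)) out-degree
                       (countFrom-complement (suc p) (suc e′) (0 ⟶_)) many classBound)
    where
    p : ℕ
    p = suc p′
    reachedBefore unreachedBefore : ℕ
    reachedBefore   = countFrom 1 p′ (λ n → (0 ⟶ n) ∧ (n ⟶ p))
    unreachedBefore = countFrom 1 p′ (λ n → not (0 ⟶ n))
    window<m : p + suc e′ < m
    window<m = subst (_≤ m) (+-suc p (suc e′)) (≤-reflexive tail-end)
    in-degree : suc p′ ≤ 2 * (reachedBefore + unreachedBefore)
    in-degree = begin
      p                            ≤⟨ medianIn 0 p z<s (≤-<-trans (m≤m+n p (suc e′)) window<m) ⟩
      2 * countFrom 0 p (_⟶ p)     ≡⟨ cong (λ b → 2 * (indicator b + countFrom 1 p′ (_⟶ p))) p-unreached ⟩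
      2 * countFrom 1 p′ (_⟶ p)    ≤⟨ *-monoʳ-≤ 2 (countFrom-cover 1 p′ (_⟶ p) _ _ reached-or-not) ⟩
      2 * (reachedBefore + unreachedBefore) ∎
      where
      open ≤-Reasoning
      reached-or-not : ∀ n → InWindow 1 p′ n → T (n ⟶ p) → T ((0 ⟶ n) ∧ (n ⟶ p)) ⊎ T (not (0 ⟶ n))
      reached-or-not n _ n⟶p with 0 ⟶ n
      ... | true  = inj₁ n⟶p
      ... | false = inj₂ tt
    out-degree : p′ + suc (suc e′) ≤ 2 * (countFrom 1 p′ (0 ⟶_) + countFrom (suc p) (suc e′) (0 ⟶_))
    out-degree = begin
      p′ + suc (suc e′)
        ≤⟨ medianOut 0 (p′ + suc (suc e′)) 0<m′ (≤-reflexive tail-end) ⟩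
      2 * countFrom 1 (p′ + suc (suc e′)) (0 ⟶_)
        ≡⟨ cong (2 *_) (countFrom-++ 1 p′ (suc (suc e′)) (0 ⟶_)) ⟩
      2 * (countFrom 1 p′ (0 ⟶_) + (indicator (0 ⟶ p) + countFrom (suc p) (suc e′) (0 ⟶_)))
        ≡⟨ cong (λ b → 2 * (countFrom 1 p′ (0 ⟶_) + (indicator b + countFrom (suc p) (suc e′) (0 ⟶_)))) p-unreached ⟩
      2 * (countFrom 1 p′ (0 ⟶_) + countFrom (suc p) (suc e′) (0 ⟶_)) ∎
      where
      open ≤-Reasoning
      0<m′ : 0 < p′ + suc (suc e′)
      0<m′ = subst (0 <_) (sym (+-suc p′ (suc e′))) z<s

  sparseTail : ∀ {k′} r d → suc r + d ≡ m → 2 * suc k′ ≤ countFrom (suc r) d (λ n → not (0 ⟶ n)) →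
    PathsIntoTail (suc k′) (suc r)
  sparseTail {k′} r d tail-end many with firstFalse (suc r) d (0 ⟶_) (≤-trans (s≤s z≤n) many)
  ... | j , e , refl , p-unreached , none-before = atPivot e tail-end many-after
    where
    unreached-after : ℕ → ℕ
    unreached-after e = countFrom (suc (suc (r + j))) e (λ n → not (0 ⟶ n))
    many-after : 2 * suc k′ ≤ suc (unreached-after e)
    many-after = begin
      2 * suc k′                                               ≤⟨ many ⟩
      countFrom (suc r) (j + suc e) (λ n → not (0 ⟶ n))      ≡⟨ countFrom-++ (suc r) j (suc e) _ ⟩
      countFrom (suc r) j (λ n → not (0 ⟶ n)) + countFrom (suc (r + j)) (suc e) (λ n → not (0 ⟶ n))
        ≡⟨ cong₂ (λ x b → x + (indicator (not b) + unreached-after e)) none-before p-unreached ⟩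
      suc (unreached-after e)                                  ∎
      where
      open ≤-Reasoning
    atPivot : ∀ e → suc r + (j + suc e) ≡ m → 2 * suc k′ ≤ suc (unreached-after e) →
              PathsIntoTail (suc k′) (suc r)
    atPivot zero     _        2k≤1  = ⊥-elim (<⇒≱ (≤-trans (*-monoʳ-≤ 2 (s≤s z≤n)) 2k≤1) ≤-refl)
    atPivot (suc e′) tail-end many′ =
      unreachedPivot (suc r) (r + j) e′ (s≤s (m≤m+n r j)) (trans (cong suc (+-assoc r j _)) tail-end)
                     p-unreached many′

  pathsIntoTail : ∀ r k′ → suc r + (3 + 4 * k′) ≡ m → PathsIntoTail (suc k′) (suc r)
  pathsIntoTail r k′ tail-end with 2 * suc k′ ≤? countFrom (suc r) (3 + 4 * k′) (0 ⟶_)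
  ... | yes many = denseTail (suc r) (2 + 4 * k′) (≤-reflexive tail-end) many
  ... | no  few  = sparseTail r (3 + 4 * k′) tail-end
                     (complement-≥ (countFrom-complement (suc r) (3 + 4 * k′) (0 ⟶_)) (≰⇒> few))

mainTheorem12 : (k : ℕ) → 1 ≤ k → (m : ℕ) → 4 * k ≤ m →
    (T : Tournament m) → (σ : Ordering m) → IsLocalMedianOrder T σ →
    (o : Fin m) → toℕ o ≡ 0 →
    Σ (Fin k → Fin m) λ mid → Σ (Fin k → Fin m) λ end →
      InternallyDisjoint2OutPaths T k (σ ⟨$⟩ʳ o) mid end ×
      (∀ t → Σ (Fin m) λ p → (end t ≡ σ ⟨$⟩ʳ p) × (m ∸ 4 * k + 1 ≤ toℕ p))
mainTheorem12 (suc k′) _ zero ()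
mainTheorem12 (suc k′) _ (suc m′) 4k≤m G σ median (fsuc _) ()
mainTheorem12 (suc k′) _ (suc m′) 4k≤m G σ median fzero refl
  rewrite +-comm (suc m′ ∸ 4 * suc k′) 1 = pathsIntoTail (suc m′ ∸ 4 * suc k′) k′ tail-end
  where
  open MedianOrder G σ median using (pathsIntoTail)
  tail-end : suc (suc m′ ∸ 4 * suc k′) + (3 + 4 * k′) ≡ suc m′
  tail-end = trans (regroup (suc m′ ∸ 4 * suc k′) k′) (m∸n+n≡m 4k≤m)
    where
    regroup : ∀ r k′ → suc r + (3 + 4 * k′) ≡ r + 4 * suc k′
    regroup = solve-∀
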